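{- Let $G$ be a ribbon graph, $e\in E(G)$, and $n$ a positive integer. Then $f_n(G)=f_n(G\backslash e)+f_n(G/e)$. In particular, $\kappa(G)=\kappa(G\backslash e)+\kappa(G/e)$.
   Context: A ribbon graph $G=(V,E)$ is a surface with boundary formed by a set $V$ of vertex discs and a set $E$ of edge discs (ribbons), such that vertices and edges meet in disjoint line segments, each lying on the boundary of exactly one vertex and exactly one edge, and each edge contains exactly two such segments. For $F\subseteq E$, $(V,F)$ is the spanning ribbon subgraph obtained by deleting the edges not in $F$. $f_n(G)$ is the number of $F\subseteq E$ such that $(V,F)$ has exactly $n$ boundary components; $\kappa(G)=f_1(G)$ (the number of spanning quasi-trees). Deletion: $G\backslash e=(V,E\setminus\{e\})$. Partial dual $G^{\delta(A)}$ for $A\subseteq E$: glue a disc along each boundary component of $(V,A)$ (these are the new vertices), remove the interiors of the old vertex discs, keep the edge ribbons. Contraction: $G/e=G^{\delta(\{e\})}\backslash e$. -}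

module Defs where

-- Each edge ribbon e is a rectangle with four corners, the points
-- (e , 0) (e , 1) (e , 2) (e , 3).  The two attaching segments of e
-- (where e meets vertex discs) are the sides {0,1} and {2,3}
-- (involution ι below); the two free sides of e are {0,3} and {1,2}
-- (involution ε below).  The boundary of a vertex disc consists of its
-- attaching segments and of "vertex arcs" joining endpoints of
-- consecutive attaching segments; ν pairs the two endpoints of each
-- vertex arc.  Any fixed-point-free involution ν encodes a ribbon graph
-- and every ribbon graph arises this way (twists are encoded by ν).
-- Vertices without any incident edge carry no corner points; their
-- number is recorded separately (field iso).
--
--   vertices of G                       = orbits of ⟨ν , ι⟩  +  iso
--   boundary components of (V , F)      = orbits of ⟨ν , ε_F⟩ + iso
-- where ε_F acts as ε on corners of edges of F and as ι on corners of
-- the deleted edges (their attaching segments become part of the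
-- vertex boundary).

open import Data.Nat using (ℕ; zero; suc; _+_; _*_; _<ᵇ_)
open import Data.Nat.Properties using () renaming (_≟_ to _≟ℕ_)
open import Data.Fin using (Fin; zero; suc; toℕ; punchIn; punchOut)
open import Data.Fin.Properties using (_≟_; punchInᵢ≢i)
open import Data.Fin.Subset using (Subset; _∈_; ⁅_⁆)
open import Data.Fin.Subset.Properties using (_∈?_)
open import Data.Product using (_×_; _,_; proj₁; proj₂)
open import Data.Bool renaming (_≟_ to _≟ᵇ_) using (Bool; true; false; _∨_; _∧_; not; if_then_else_)
open import Data.List using (List; []; _∷_; map; _++_; filter; length; concatMap)
open import Data.Bool.ListAction using (any; all)
open import Data.Vec using (Vec; []; _∷_)
open import Relation.Nullary using (yes; no; does)
open import Relation.Binary.PropositionalEquality using (_≡_; _≢_)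

Point : ℕ → Set
Point m = Fin m × Fin 4

record Ribbon (m : ℕ) : Set where
  constructor ribbon
  field
    ν   : Point m → Point m
    iso : ℕ
open Ribbon public

IsRibbon : ∀ {m} → Ribbon m → Set
IsRibbon {m} G = (∀ (p : Point m) → ν G (ν G p) ≡ p) × (∀ (p : Point m) → ν G p ≢ p)

ι₄ ε₄ : Fin 4 → Fin 4
ι₄ zero = suc zero
ι₄ (suc zero) = zero
ι₄ (suc (suc zero)) = suc (suc (suc zero))
ι₄ (suc (suc (suc zero))) = suc (suc zero)
ε₄ zero = suc (suc (suc zero))
ε₄ (suc zero) = suc (suc zero)
ε₄ (suc (suc zero)) = suc zero
ε₄ (suc (suc (suc zero))) = zero

ι ε : ∀ {m} → Point m → Point m
ι (e , c) = e , ι₄ c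
ε (e , c) = e , ε₄ c

ε[_] : ∀ {m} → Subset m → Point m → Point m
ε[ F ] (e , c) = if does (e ∈? F) then ε (e , c) else ι (e , c)

allFin' : (n : ℕ) → List (Fin n)
allFin' zero = []
allFin' (suc n) = zero ∷ map suc (allFin' n)

allPoints : (m : ℕ) → List (Point m)
allPoints m = concatMap (λ e → map (e ,_) (allFin' 4)) (allFin' m)

_==_ : ∀ {m} → Point m → Point m → Bool
(e , c) == (e' , c') = does (e ≟ e') ∧ does (c ≟ c')

key : ∀ {m} → Point m → ℕ
key (e , c) = toℕ e * 4 + toℕ c

reach : ∀ {m} → ℕ → (Point m → Point m) → (Point m → Point m) → Point m → Point m → Bool
reach zero    a b p q = p == q
reach (suc k) a b p q = reach k a b p q ∨ reach k a b (a p) q ∨ reach k a b (b p) q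

-- p is the point of smallest key in its ⟨a , b⟩-orbit
-- (an orbit has at most 4m points, so words of length 4m suffice)
isRep : ∀ {m} → (Point m → Point m) → (Point m → Point m) → Point m → Bool
isRep {m} a b p = not (any (λ q → (key q <ᵇ key p) ∧ reach (m * 4) a b p q) (allPoints m))

orbits : ∀ {m} → (Point m → Point m) → (Point m → Point m) → ℕ
orbits {m} a b = length (filter (λ p → isRep a b p ≟ᵇ true) (allPoints m))

bc : ∀ {m} → Ribbon m → Subset m → ℕ
bc G F = orbits (ν G) ε[ F ] + iso G

subsets : (m : ℕ) → List (Subset m)
subsets zero = [] ∷ []
subsets (suc m) = map (true ∷_) (subsets m) ++ map (false ∷_) (subsets m)

f : ℕ → ∀ {m} → Ribbon m → ℕ
f n {m} G = length (filter (λ F → bc G F ≟ℕ n) (subsets m))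

κ : ∀ {m} → Ribbon m → ℕ
κ G = f 1 G

-- deletion  G \ e   (edges of G \ e are identified with Fin m via punchIn e)

-- follow the vertex boundary of G past the attaching segments of e
exit : ∀ {m} → Ribbon (suc m) → Fin (suc m) → ℕ → Point m → Point (suc m) → Point m
exit G e fuel       dflt (i , c) with e ≟ i
exit G e fuel       dflt (i , c) | no e≢i = punchOut e≢i , c
exit G e zero       dflt (i , c) | yes _  = dflt
exit G e (suc fuel) dflt (i , c) | yes _  = exit G e fuel dflt (ν G (ι (i , c)))

onEdge : ∀ {m} → Fin m → Point m → Bool
onEdge e (i , _) = does (e ≟ i)

newIsolated : ∀ {m} → Ribbon m → Fin m → ℕ
newIsolated {m} G e =
  length (filter (λ p → (onEdge e p ∧ isRep (ν G) ι p
                         ∧ all (λ q → not (reach (m * 4) (ν G) ι p q) ∨ onEdge e q) (allPoints m))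
                        ≟ᵇ true)
                 (allPoints (m)))

_\\_ : ∀ {m} → Ribbon (suc m) → Fin (suc m) → Ribbon m
G \\ e = ribbon (λ { (i , c) → exit G e 3 (i , c) (ν G (punchIn e i , c)) })
                (iso G + newIsolated G e)

-- partial duality  G^{δ(A)}  and contraction  G / e = G^{δ({e})} \ e
-- Partial duality exchanges the attaching segments and the free sides of
-- each edge of A; relabelling corners 1 ↔ 3 on these edges restores the
-- standard labelling (ι , ε).  Vertex arcs are unchanged.

swap13 : Fin 4 → Fin 4
swap13 zero = zero
swap13 (suc zero) = suc (suc (suc zero))
swap13 (suc (suc zero)) = suc (suc zero)
swap13 (suc (suc (suc zero))) = suc zero

π[_] : ∀ {m} → Subset m → Point m → Point m
π[ A ] (e , c) = if does (e ∈? A) then (e , swap13 c) else (e , c)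

_^δ_ : ∀ {m} → Ribbon m → Subset m → Ribbon m
G ^δ A = ribbon (λ p → π[ A ] (ν G (π[ A ] p))) (iso G)

_/_ : ∀ {m} → Ribbon (suc m) → Fin (suc m) → Ribbon m
G / e = (G ^δ ⁅ e ⁆) \\ e

{-# OPTIONS --safe #-}
-- Boundary components of a spanning ribbon subgraph (V, F) are the orbits of two involutions on
-- the corners of the edges (plus the isolated vertices), so f n G counts the subsets F by their
-- number of orbits.  Split the subsets F according to whether they contain e.
-- If e ∉ F, the orbits of G correspond to those of G \ e, except for the orbits lying entirely on
-- the corners of e, which deletion turns into isolated vertices; this works because a vertex arc
-- of G \ e is a walk along the boundary of G through at most two attaching segments of e.
-- If e ∈ F, relabelling the corners of e conjugates the involutions of (V, F) in G into those of
-- (V, F − e) in the partial dual G^δ(e), and deleting e from G^δ(e) gives G / e.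
-- Orbit counts are compared by double counting against transversals, i.e. sets of points that
-- meet every orbit exactly once.
module Submission where

open import Defs

open import Algebra.Definitions using (Involutive)
open import Data.Bool using (Bool; true; false; _∨_; _∧_; not; if_then_else_)
open import Data.Bool.ListAction using (any; all)
open import Data.Bool.Properties using (¬-not; ∧-zeroʳ; ∧-identityʳ; not-injective; T-≡)
  renaming (_≟_ to _≟ᵇ_)
open import Data.Empty using (⊥; ⊥-elim)
open import Data.Fin using (Fin; zero; suc; toℕ; combine; punchIn; punchOut)
open import Data.Fin.Properties
  using (_≟_; all?; toℕ-injective; toℕ-combine; combine-injective;
         punchInᵢ≢i; punchIn-punchOut; punchIn-injective; punchOut-punchIn)
open import Data.Fin.Subset using (Subset; ⁅_⁆)
open import Data.Fin.Subset.Properties using (_∈?_; x∈⁅x⁆; x≢y⇒x∉⁅y⁆)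
open import Data.List using (List; []; _∷_; map; _++_; filter; length; concatMap)
open import Data.List.Membership.Propositional using (_∈_)
open import Data.List.Membership.Propositional.Properties using (∈-map⁺; ∈-concatMap⁺)
open import Data.List.Relation.Unary.Any using (here; there)
import Data.List.Relation.Unary.Any as Any
open import Data.Nat
  using (ℕ; zero; suc; _+_; _*_; _≤_; _<_; _≮_; _<ᵇ_; _≤′_; ≤′-refl; ≤′-step; z≤n; s≤s)
open import Data.Nat.Induction using (<-wellFounded)
open import Data.Nat.Properties
  using (+-comm; +-assoc; +-identityʳ; +-suc; *-comm; *-zeroʳ; *-identityʳ; *-distribˡ-+;
         +-mono-≤; +-monoˡ-≤; +-mono-<-≤; ≤-refl; ≤-reflexive; ≤-trans; ≤-antisym; <-irrefl;
         <⇒≤; ≮⇒≥; m≤m+n; m≤n+m; m≤n⇒m<n∨m≡n; m<n⇒m<1+n; n<1+n; 1+n≰n; ≤⇒≤′; <ᵇ⇒<; <⇒<ᵇ;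
         +-commutativeSemigroup; *-commutativeSemigroup)
  renaming (_≟_ to _≟ℕ_)
open import Algebra.Properties.CommutativeSemigroup +-commutativeSemigroup using (interchange)
  renaming (x∙yz≈y∙xz to x+[y+z]≡y+[x+z])
open import Algebra.Properties.CommutativeSemigroup *-commutativeSemigroup using ()
  renaming (x∙yz≈y∙xz to x*[y*z]≡y*[x*z])
open import Data.Product using (_×_; _,_; proj₁; proj₂; ∃-syntax)
open import Data.Sum using (_⊎_; inj₁; inj₂; [_,_]′)
open import Data.Vec using (_∷_; lookup; insertAt)
open import Data.Vec.Properties using (insertAt-lookup; insertAt-punchIn)
open import Function using (_∘_; id; _⇔_; mk⇔; Equivalence; case_of_)
import Function.Properties.Equivalence as ⇔
open import Induction.WellFounded using (Acc; acc)
open import Level using (0ℓ)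
open import Relation.Binary using (Rel; IsEquivalence; Symmetric)
import Relation.Binary.Construct.On as On
open import Relation.Binary.Construct.Closure.ReflexiveTransitive
  using (Star; _◅_; _◅◅_; gmap; kleisliStar; reverse)
  renaming (ε to ε★)
open import Relation.Nullary using (Dec; yes; no; does; ¬_)
open import Relation.Nullary.Decidable
  using (dec-true; dec-false; dec-yes; dec-no; from-yes; _⊎-dec_)
open import Relation.Binary.PropositionalEquality
  using (_≡_; _≢_; refl; sym; trans; cong; cong₂; subst; subst₂; module ≡-Reasoning)

private variable
  A B : Set
  m n : ℕ

χ : Bool → ℕ
χ true  = 1
χ false = 0

χ≤1 : ∀ b → χ b ≤ 1
χ≤1 true  = ≤-refl
χ≤1 false = z≤n

χ-mono : ∀ {x y} → (x ≡ true → y ≡ true) → χ x ≤ χ y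
χ-mono {false} _   = z≤n
χ-mono {true}  x⇒y rewrite x⇒y refl = ≤-refl

χ-injective : ∀ {x y} → χ x ≡ χ y → x ≡ y
χ-injective {false} {false} _ = refl
χ-injective {true}  {true}  _ = refl

χ*χ-vanishes : ∀ {x y} → (x ≡ true → y ≡ true → ⊥) → χ x * χ y ≡ 0
χ*χ-vanishes {false}        _    = refl
χ*χ-vanishes {true} {false} _    = refl
χ*χ-vanishes {true} {true}  both = ⊥-elim (both refl refl)

χ-*-cong : ∀ {u v} y → (y ≡ true → u ≡ v) → χ u * χ y ≡ χ v * χ y
χ-*-cong         true  u≡v = cong (λ t → χ t * 1) (u≡v refl)
χ-*-cong {u} {v} false _   = trans (*-zeroʳ (χ u)) (sym (*-zeroʳ (χ v)))

does≡true⇒ : ∀ {P : Set} (P? : Dec P) → does P? ≡ true → P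
does≡true⇒ (yes p) _ = p

does-≟true : ∀ b → does (b ≟ᵇ true) ≡ b
does-≟true true  = refl
does-≟true false = refl

≡-from-⇔ : ∀ {x y : Bool} → (x ≡ true → y ≡ true) → (y ≡ true → x ≡ true) → x ≡ y
≡-from-⇔ {false} {false} _ _ = refl
≡-from-⇔ {false} {true}  _ g = g refl
≡-from-⇔ {true}  {false} f _ = sym (f refl)
≡-from-⇔ {true}  {true}  _ _ = refl

∨-true-introˡ : ∀ {x} y → x ≡ true → x ∨ y ≡ true
∨-true-introˡ _ refl = refl

∨-true-introʳ : ∀ x {y} → y ≡ true → x ∨ y ≡ true
∨-true-introʳ true  _ = refl
∨-true-introʳ false h = h

∨-true-elim : ∀ x {y} → x ∨ y ≡ true → x ≡ true ⊎ y ≡ true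
∨-true-elim true  _ = inj₁ refl
∨-true-elim false h = inj₂ h

∧-true-intro : ∀ {x y} → x ≡ true → y ≡ true → x ∧ y ≡ true
∧-true-intro refl refl = refl

∧-true-elim : ∀ x {y} → x ∧ y ≡ true → x ≡ true × y ≡ true
∧-true-elim true h = refl , h

<ᵇ≡true⇒< : ∀ {x y} → (x <ᵇ y) ≡ true → x < y
<ᵇ≡true⇒< {x} {y} h = <ᵇ⇒< x y (Equivalence.from T-≡ h)

<⇒<ᵇ≡true : ∀ {x y} → x < y → (x <ᵇ y) ≡ true
<⇒<ᵇ≡true x<y = Equivalence.to T-≡ (<⇒<ᵇ x<y)

any-cong : ∀ {f g : A → Bool} → (∀ x → f x ≡ g x) → ∀ xs → any f xs ≡ any g xs
any-cong f≡g []       = refl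
any-cong f≡g (x ∷ xs) = cong₂ _∨_ (f≡g x) (any-cong f≡g xs)

all-cong : ∀ {f g : A → Bool} → (∀ x → f x ≡ g x) → ∀ xs → all f xs ≡ all g xs
all-cong f≡g []       = refl
all-cong f≡g (x ∷ xs) = cong₂ _∧_ (f≡g x) (all-cong f≡g xs)

any-witness : ∀ (f : A → Bool) xs → any f xs ≡ true → ∃[ x ] f x ≡ true
any-witness f (x ∷ xs) h with ∨-true-elim (f x) h
... | inj₁ fx   = x , fx
... | inj₂ rest = any-witness f xs rest

any-∈ : ∀ (f : A → Bool) {x xs} → x ∈ xs → f x ≡ true → any f xs ≡ true
any-∈ f {xs = _ ∷ _}  (here refl) fx = ∨-true-introˡ _ fx
any-∈ f {xs = y ∷ _}  (there x∈)  fx = ∨-true-introʳ (f y) (any-∈ f x∈ fx)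

all-∈ : ∀ (f : A → Bool) {x xs} → x ∈ xs → all f xs ≡ true → f x ≡ true
all-∈ f {xs = y ∷ _} (here refl) h = proj₁ (∧-true-elim (f y) h)
all-∈ f {xs = y ∷ _} (there x∈)  h = all-∈ f x∈ (proj₂ (∧-true-elim (f y) h))

all-counterexample : ∀ (f : A → Bool) xs → all f xs ≡ false → ∃[ x ] f x ≡ false
all-counterexample f (x ∷ xs) h with f x in fx
... | false = x , fx
... | true  = all-counterexample f xs h

∑ : List A → (A → ℕ) → ℕ
∑ []       g = 0
∑ (x ∷ xs) g = g x + ∑ xs g

infix 5 ∑
syntax ∑ xs (λ x → g) = ∑[ x ∈ xs ] g

∑-cong : ∀ xs {g h : A → ℕ} → (∀ x → g x ≡ h x) → ∑ xs g ≡ ∑ xs h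
∑-cong []       _   = refl
∑-cong (x ∷ xs) g≡h = cong₂ _+_ (g≡h x) (∑-cong xs g≡h)

∑-mono-≤ : ∀ xs {g h : A → ℕ} → (∀ x → g x ≤ h x) → ∑ xs g ≤ ∑ xs h
∑-mono-≤ []       _   = z≤n
∑-mono-≤ (x ∷ xs) g≤h = +-mono-≤ (g≤h x) (∑-mono-≤ xs g≤h)

∑-zero : ∀ xs {g : A → ℕ} → (∀ x → g x ≡ 0) → ∑ xs g ≡ 0
∑-zero []       _   = refl
∑-zero (x ∷ xs) g≡0 = cong₂ _+_ (g≡0 x) (∑-zero xs g≡0)

∑-++ : ∀ xs ys (g : A → ℕ) → ∑ (xs ++ ys) g ≡ ∑ xs g + ∑ ys g
∑-++ []       ys g = refl
∑-++ (x ∷ xs) ys g = trans (cong (g x +_) (∑-++ xs ys g)) (sym (+-assoc (g x) _ _))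

∑-map : ∀ xs (f : A → B) (g : B → ℕ) → ∑ (map f xs) g ≡ ∑ xs (g ∘ f)
∑-map []       f g = refl
∑-map (x ∷ xs) f g = cong (g (f x) +_) (∑-map xs f g)

∑-concatMap : ∀ xs (f : A → List B) (g : B → ℕ) → ∑ (concatMap f xs) g ≡ ∑[ x ∈ xs ] ∑ (f x) g
∑-concatMap []       f g = refl
∑-concatMap (x ∷ xs) f g =
  trans (∑-++ (f x) (concatMap f xs) g) (cong (∑ (f x) g +_) (∑-concatMap xs f g))

∑-+ : ∀ xs (g h : A → ℕ) → ∑[ x ∈ xs ] (g x + h x) ≡ ∑ xs g + ∑ xs h
∑-+ []       g h = refl
∑-+ (x ∷ xs) g h = trans (cong (g x + h x +_) (∑-+ xs g h)) (interchange (g x) (h x) _ _)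

∑-*ˡ : ∀ xs c (g : A → ℕ) → ∑[ x ∈ xs ] (c * g x) ≡ c * ∑ xs g
∑-*ˡ []       c g = sym (*-zeroʳ c)
∑-*ˡ (x ∷ xs) c g = trans (cong (c * g x +_) (∑-*ˡ xs c g)) (sym (*-distribˡ-+ c (g x) _))

∑-comm : ∀ xs ys (h : A → B → ℕ) → ∑[ x ∈ xs ] ∑ ys (h x) ≡ ∑[ y ∈ ys ] ∑[ x ∈ xs ] h x y
∑-comm []       ys h = sym (∑-zero ys (λ _ → refl))
∑-comm (x ∷ xs) ys h = trans (cong (∑ ys (h x) +_) (∑-comm xs ys h)) (sym (∑-+ ys (h x) _))

∑-≥-∈ : ∀ (g : A → ℕ) {x xs} → x ∈ xs → g x ≤ ∑ xs g
∑-≥-∈ g {xs = _ ∷ ys} (here refl) = m≤m+n _ (∑ ys g)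
∑-≥-∈ g {xs = y ∷ _}  (there x∈)  = ≤-trans (∑-≥-∈ g x∈) (m≤n+m _ (g y))

+-≤-≡ˡ : ∀ {a b c d} → a ≤ c → b ≤ d → a + b ≡ c + d → a ≡ c
+-≤-≡ˡ a≤c b≤d eq with m≤n⇒m<n∨m≡n a≤c
... | inj₁ a<c = ⊥-elim (<-irrefl eq (+-mono-<-≤ a<c b≤d))
... | inj₂ a≡c = a≡c

+-≤-≡ʳ : ∀ {a b c d} → a ≤ c → b ≤ d → a + b ≡ c + d → b ≡ d
+-≤-≡ʳ {a} {b} {c} {d} a≤c b≤d eq = +-≤-≡ˡ b≤d a≤c (trans (+-comm b a) (trans eq (+-comm c d)))

∑-≤-≡ : ∀ {g h : A → ℕ} {x xs} → (∀ y → g y ≤ h y) → ∑ xs g ≡ ∑ xs h → x ∈ xs → g x ≡ h x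
∑-≤-≡ {xs = y ∷ ys} g≤h eq (here refl) = +-≤-≡ˡ (g≤h y) (∑-mono-≤ ys g≤h) eq
∑-≤-≡ {xs = y ∷ ys} g≤h eq (there x∈) = ∑-≤-≡ g≤h (+-≤-≡ʳ (g≤h y) (∑-mono-≤ ys g≤h) eq) x∈

length-filter-∑ : ∀ {P : A → Set} (P? : ∀ x → Dec (P x)) xs →
  length (filter P? xs) ≡ ∑[ x ∈ xs ] χ (does (P? x))
length-filter-∑ P? []       = refl
length-filter-∑ P? (x ∷ xs) with does (P? x)
... | true  = cong suc (length-filter-∑ P? xs)
... | false = length-filter-∑ P? xs

∑-allFin'-punchIn : ∀ (i : Fin (suc n)) (g : Fin (suc n) → ℕ) →
  ∑ (allFin' (suc n)) g ≡ g i + ∑ (allFin' n) (g ∘ punchIn i)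
∑-allFin'-punchIn {n}     zero    g = cong (g zero +_) (∑-map (allFin' n) suc g)
∑-allFin'-punchIn {suc n} (suc i) g = begin
  g zero + ∑ (map suc (allFin' (suc n))) g
    ≡⟨ cong (g zero +_) (∑-map (allFin' (suc n)) suc g) ⟩
  g zero + ∑ (allFin' (suc n)) (g ∘ suc)
    ≡⟨ cong (g zero +_) (∑-allFin'-punchIn i (g ∘ suc)) ⟩
  g zero + (g (suc i) + ∑ (allFin' n) (g ∘ suc ∘ punchIn i))
    ≡⟨ x+[y+z]≡y+[x+z] (g zero) (g (suc i)) _ ⟩
  g (suc i) + (g zero + ∑ (allFin' n) (g ∘ suc ∘ punchIn i))
    ≡⟨ cong (λ s → g (suc i) + (g zero + s)) (∑-map (allFin' n) suc (g ∘ punchIn (suc i))) ⟨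
  g (suc i) + ∑ (allFin' (suc n)) (g ∘ punchIn (suc i)) ∎
  where open ≡-Reasoning

∑-allFin'-δ : ∀ (i : Fin n) (g : Fin n → ℕ) → (∀ j → j ≢ i → g j ≡ 0) → ∑ (allFin' n) g ≡ g i
∑-allFin'-δ {suc n} i g vanishes = begin
  ∑ (allFin' (suc n)) g                ≡⟨ ∑-allFin'-punchIn i g ⟩
  g i + ∑ (allFin' n) (g ∘ punchIn i)  ≡⟨ cong (g i +_) (∑-zero (allFin' n) (vanishes _ ∘ punchInᵢ≢i i)) ⟩
  g i + 0                              ≡⟨ +-identityʳ (g i) ⟩
  g i                                  ∎
  where open ≡-Reasoning

∈-allFin' : ∀ (i : Fin n) → i ∈ allFin' n
∈-allFin' zero    = here refl
∈-allFin' (suc i) = there (∈-map⁺ suc (∈-allFin' i))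

∈-allPoints : ∀ (p : Point m) → p ∈ allPoints m
∈-allPoints (i , c) = ∈-concatMap⁺ (λ e → map (e ,_) (allFin' 4))
  (Any.map (λ { refl → ∈-map⁺ (i ,_) (∈-allFin' c) }) (∈-allFin' i))

∑ₚ : (Point m → ℕ) → ℕ
∑ₚ {m} g = ∑ (allPoints m) g

∑ᶜ : Fin m → (Point m → ℕ) → ℕ
∑ᶜ e g = ∑[ c ∈ allFin' 4 ] g (e , c)

punchInₚ : Fin (suc m) → Point m → Point (suc m)
punchInₚ e (i , c) = punchIn e i , c

∑ₚ-edges : ∀ (g : Point m → ℕ) → ∑ₚ g ≡ ∑[ i ∈ allFin' m ] ∑ᶜ i g
∑ₚ-edges {m} g = trans (∑-concatMap (allFin' m) (λ i → map (i ,_) (allFin' 4)) g)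
  (∑-cong (allFin' m) (λ i → ∑-map (allFin' 4) (i ,_) g))

∑ₚ-punchIn : ∀ (e : Fin (suc m)) (g : Point (suc m) → ℕ) → ∑ₚ g ≡ ∑ᶜ e g + ∑ₚ (g ∘ punchInₚ e)
∑ₚ-punchIn e g = trans (∑ₚ-edges g)
  (trans (∑-allFin'-punchIn e _) (cong (∑ᶜ e g +_) (sym (∑ₚ-edges (g ∘ punchInₚ e)))))

∑ₚ-δ : ∀ (p : Point m) (g : Point m → ℕ) → (∀ q → q ≢ p → g q ≡ 0) → ∑ₚ g ≡ g p
∑ₚ-δ {m} (i , c) g vanishes = begin
  ∑ₚ g                          ≡⟨ ∑ₚ-edges g ⟩
  ∑[ j ∈ allFin' m ] ∑ᶜ j g     ≡⟨ ∑-allFin'-δ i _ (λ j j≢i → ∑-zero (allFin' 4) (other-edge j≢i)) ⟩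
  ∑ᶜ i g                        ≡⟨ ∑-allFin'-δ c _ (λ d d≢c → vanishes (i , d) (d≢c ∘ cong proj₂)) ⟩
  g (i , c)                     ∎
  where
  open ≡-Reasoning
  other-edge : ∀ {j} → j ≢ i → ∀ d → g (j , d) ≡ 0
  other-edge {j} j≢i d = vanishes (j , d) (j≢i ∘ cong proj₁)

∑ₚ-≥ : ∀ (g : Point m → ℕ) p → g p ≤ ∑ₚ g
∑ₚ-≥ g p = ∑-≥-∈ g (∈-allPoints p)

∑ₚ-≤-≡ : ∀ {g h : Point m → ℕ} → (∀ q → g q ≤ h q) → ∑ₚ g ≡ ∑ₚ h → ∀ p → g p ≡ h p
∑ₚ-≤-≡ g≤h eq p = ∑-≤-≡ g≤h eq (∈-allPoints p)

∑ₚ-χ-≤ : ∀ (b : Point m → Bool) → ∑ₚ (χ ∘ b) ≤ m * 4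
∑ₚ-χ-≤ {m} b =
  ≤-trans (∑-mono-≤ (allPoints m) (χ≤1 ∘ b)) (≤-reflexive (trans (∑ₚ-edges {m} _) (four m)))
  where
  four : ∀ n → ∑ (allFin' n) (λ _ → 4) ≡ n * 4
  four zero    = refl
  four (suc n) = cong (4 +_) (trans (∑-map (allFin' n) suc _) (four n))

==⇒≡ : ∀ (p q : Point m) → (p == q) ≡ true → p ≡ q
==⇒≡ (i , c) (j , d) h with ∧-true-elim (does (i ≟ j)) h
... | i≡j , c≡d = cong₂ _,_ (does≡true⇒ (i ≟ j) i≡j) (does≡true⇒ (c ≟ d) c≡d)

==-refl : ∀ (p : Point m) → (p == p) ≡ true
==-refl (i , c) rewrite dec-true (i ≟ i) refl | dec-true (c ≟ c) refl = refl

χ==-*-vanishes : ∀ {p q : Point m} x → p ≢ q → χ (p == q) * x ≡ 0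
χ==-*-vanishes {p = p} {q} x p≢q = cong (λ b → χ b * x) (¬-not (p≢q ∘ ==⇒≡ p q))

χ==-*-refl : ∀ (p : Point m) x → χ (p == p) * x ≡ x
χ==-*-refl p x rewrite ==-refl p = +-identityʳ x

∑ₚ-reindex : ∀ {π : Point m → Point m} → Involutive _≡_ π → ∀ (g : Point m → ℕ) → ∑ₚ (g ∘ π) ≡ ∑ₚ g
∑ₚ-reindex {m} {π} π-inv g = begin
  ∑ₚ (g ∘ π)                                         ≡⟨ ∑-cong (allPoints m) (sym ∘ g∘π-as-∑) ⟩
  ∑[ p ∈ allPoints m ] ∑ₚ (λ q → χ (q == π p) * g q) ≡⟨ ∑-comm (allPoints m) (allPoints m) _ ⟩
  ∑[ q ∈ allPoints m ] ∑ₚ (λ p → χ (q == π p) * g q) ≡⟨ ∑-cong (allPoints m) g-as-∑ ⟩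
  ∑ₚ g                                               ∎
  where
  open ≡-Reasoning
  g∘π-as-∑ : ∀ p → ∑ₚ (λ q → χ (q == π p) * g q) ≡ g (π p)
  g∘π-as-∑ p = trans (∑ₚ-δ (π p) _ (λ q → χ==-*-vanishes (g q))) (χ==-*-refl (π p) (g (π p)))
  g-as-∑ : ∀ q → ∑ₚ (λ p → χ (q == π p) * g q) ≡ g q
  g-as-∑ q = trans (∑ₚ-δ (π q) _ vanishes) at-π
    where
    vanishes : ∀ p → p ≢ π q → χ (q == π p) * g q ≡ 0
    vanishes p p≢πq = χ==-*-vanishes (g q) (λ q≡πp → p≢πq (trans (sym (π-inv p)) (cong π (sym q≡πp))))
    at-π : χ (q == π (π q)) * g q ≡ g q
    at-π rewrite π-inv q = χ==-*-refl q (g q)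

key-injective : ∀ (p q : Point m) → key p ≡ key q → p ≡ q
key-injective (i , c) (j , d) eq = cong₂ _,_ (proj₁ same) (proj₂ same)
  where
  open ≡-Reasoning
  same : i ≡ j × c ≡ d
  same = combine-injective i c j d (toℕ-injective (begin
    toℕ (combine i c)   ≡⟨ toℕ-combine i c ⟩
    4 * toℕ i + toℕ c   ≡⟨ cong (_+ toℕ c) (*-comm 4 (toℕ i)) ⟩
    toℕ i * 4 + toℕ c   ≡⟨ eq ⟩
    toℕ j * 4 + toℕ d   ≡⟨ cong (_+ toℕ d) (*-comm (toℕ j) 4) ⟩
    4 * toℕ j + toℕ d   ≡⟨ toℕ-combine j d ⟨
    toℕ (combine j d)   ∎))

private variable
  k : ℕ
  a b : Point m → Point m
  p q r : Point m

data Step (a b : Point m → Point m) (p : Point m) : Point m → Set where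
  along-a : Step a b p (a p)
  along-b : Step a b p (b p)

Connected : (a b : Point m → Point m) → Rel (Point m) 0ℓ
Connected a b = Star (Step a b)

reach-suc-self : ∀ k {p q} → reach k a b p q ≡ true → reach (suc k) a b p q ≡ true
reach-suc-self k h = ∨-true-introˡ _ h

reach-suc-step : ∀ k {p r q} → Step a b p r → reach k a b r q ≡ true → reach (suc k) a b p q ≡ true
reach-suc-step {a = a} {b} k {p} {q = q} along-a h =
  ∨-true-introʳ (reach k a b p q) (∨-true-introˡ (reach k a b (b p) q) h)
reach-suc-step {a = a} {b} k {p} {q = q} along-b h =
  ∨-true-introʳ (reach k a b p q) (∨-true-introʳ (reach k a b (a p) q) h)

reach-suc-inv : ∀ k {p q} → reach (suc k) a b p q ≡ true →
  reach k a b p q ≡ true ⊎ ∃[ r ] Step a b p r × reach k a b r q ≡ true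
reach-suc-inv {a = a} {b} k {p} {q} h with ∨-true-elim (reach k a b p q) h
... | inj₁ now   = inj₁ now
... | inj₂ later with ∨-true-elim (reach k a b (a p) q) later
...   | inj₁ via-a = inj₂ (a p , along-a , via-a)
...   | inj₂ via-b = inj₂ (b p , along-b , via-b)

reach-sound : ∀ k {p q} → reach k a b p q ≡ true → Connected a b p q
reach-sound zero    {p} {q} h = subst (Connected _ _ p) (==⇒≡ p q h) ε★
reach-sound (suc k)         h with reach-suc-inv k h
... | inj₁ h′           = reach-sound k h′
... | inj₂ (_ , s , h′) = s ◅ reach-sound k h′

reach-snoc : ∀ k {p r q} → reach k a b p r ≡ true → Step a b r q → reach (suc k) a b p q ≡ true
reach-snoc zero {p} {r} {q} h s with ==⇒≡ p r h
... | refl = reach-suc-step zero s (==-refl q)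
reach-snoc (suc k) h s with reach-suc-inv k h
... | inj₁ h′            = reach-suc-self (suc k) (reach-snoc k h′ s)
... | inj₂ (_ , s′ , h′) = reach-suc-step (suc k) s′ (reach-snoc k h′ s)

reach-mono : ∀ {k k′ p q} → k ≤ k′ → reach k a b p q ≡ true → reach k′ a b p q ≡ true
reach-mono {a = a} {b} {p = p} {q} k≤k′ = go (≤⇒≤′ k≤k′)
  where
  go : ∀ {k k′} → k ≤′ k′ → reach k a b p q ≡ true → reach k′ a b p q ≡ true
  go ≤′-refl            h = h
  go (≤′-step {n} k≤′n) h = reach-suc-self n (go k≤′n h)

stall-or-grow : ∀ (f : ℕ → ℕ) → (∀ k → f k ≤ f (suc k)) → ∀ n →
  (∃[ k ] k < n × f (suc k) ≡ f k) ⊎ f 0 + n ≤ f n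
stall-or-grow f mono zero = inj₂ (≤-reflexive (+-identityʳ (f 0)))
stall-or-grow f mono (suc n) with stall-or-grow f mono n
... | inj₁ (k , k<n , stalled) = inj₁ (k , m<n⇒m<1+n k<n , stalled)
... | inj₂ grown with m≤n⇒m<n∨m≡n (mono n)
...   | inj₁ growing = inj₂ (≤-trans (≤-reflexive (+-suc (f 0) n)) (≤-trans (s≤s grown) growing))
...   | inj₂ same    = inj₁ (n , n<1+n n , sym same)

bounded-monotone-stalls : ∀ (f : ℕ → ℕ) B → (∀ k → f k ≤ f (suc k)) → (∀ k → f k ≤ B) → 1 ≤ f 0 →
  ∃[ k ] k < B × f (suc k) ≡ f k
bounded-monotone-stalls f B mono bounded positive with stall-or-grow f mono B
... | inj₁ stalled = stalled
... | inj₂ grown   = ⊥-elim (1+n≰n (≤-trans (+-monoˡ-≤ B positive) (≤-trans grown (bounded B))))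

reachable : ℕ → (a b : Point m → Point m) → Point m → ℕ
reachable k a b p = ∑ₚ (χ ∘ reach k a b p)

reach-stalled-closed : ∀ {m} k {a b : Point m → Point m} {p q r} →
  reachable (suc k) a b p ≡ reachable k a b p →
  reach k a b p r ≡ true → Connected a b r q → reach k a b p q ≡ true
reach-stalled-closed k stalled h ε★ = h
reach-stalled-closed k {a} {b} {p} stalled h (s ◅ path) =
  reach-stalled-closed k {a} {b} {p} stalled (trans (χ-injective (same _)) (reach-snoc k h s)) path
  where
  same : ∀ q → χ (reach k a b p q) ≡ χ (reach (suc k) a b p q)
  same = ∑ₚ-≤-≡ {g = χ ∘ reach k a b p} (λ q → χ-mono (reach-suc-self k)) (sym stalled)

-- The number of points reachable in k steps grows with k and is at most m * 4, so it stalls at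
-- some k < m * 4; the set reachable in k steps is then closed under a and b.
reach-complete : ∀ {m} {a b : Point m → Point m} {p q} → Connected a b p q → reach (m * 4) a b p q ≡ true
reach-complete {m} {a} {b} {p} path
  with bounded-monotone-stalls (λ k → reachable k a b p) (m * 4)
         (λ k → ∑-mono-≤ (allPoints m) (λ q → χ-mono (reach-suc-self k)))
         (λ k → ∑ₚ-χ-≤ (reach k a b p))
         (subst (_≤ reachable 0 a b p) (cong χ (==-refl p)) (∑ₚ-≥ _ p))
... | k , k<B , stalled = reach-mono (<⇒≤ k<B) (reach-stalled-closed k stalled p⇝p path)
  where
  p⇝p : reach k a b p p ≡ true
  p⇝p = reach-mono {k′ = k} {p} {p} z≤n (==-refl p)

sameOrbit : (a b : Point m → Point m) → Point m → Point m → Bool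
sameOrbit {m} a b = reach (m * 4) a b

Holds : (Point m → Point m → Bool) → Rel (Point m) 0ℓ
Holds R p q = R p q ≡ true

sameOrbit⇔Connected : ∀ {m} {a b : Point m → Point m} {p q} →
  Holds (sameOrbit a b) p q ⇔ Connected a b p q
sameOrbit⇔Connected {m} = mk⇔ (reach-sound (m * 4)) reach-complete

Connected-isEquivalence : ∀ {m} {a b : Point m → Point m} → Involutive _≡_ a → Involutive _≡_ b →
  IsEquivalence (Connected a b)
Connected-isEquivalence {a = a} {b} a-inv b-inv = record
  { refl  = ε★
  ; sym   = reverse step-sym
  ; trans = _◅◅_
  }
  where
  step-sym : ∀ {p q} → Step a b p q → Step a b q p
  step-sym {p} along-a = subst (Step a b (a p)) (a-inv p) along-a
  step-sym {p} along-b = subst (Step a b (b p)) (b-inv p) along-b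

isEquivalence-⇔ : ∀ {A : Set} {_∼_ _≈_ : Rel A 0ℓ} → (∀ {x y} → x ∼ y ⇔ x ≈ y) →
  IsEquivalence _≈_ → IsEquivalence _∼_
isEquivalence-⇔ ∼⇔≈ ≈-equiv = record
  { refl  = from ∼⇔≈ refl′
  ; sym   = λ x∼y → from ∼⇔≈ (sym′ (to ∼⇔≈ x∼y))
  ; trans = λ x∼y y∼z → from ∼⇔≈ (trans′ (to ∼⇔≈ x∼y) (to ∼⇔≈ y∼z))
  }
  where
  open Equivalence
  open IsEquivalence ≈-equiv renaming (refl to refl′; sym to sym′; trans to trans′)

sameOrbit-isEquivalence : ∀ {m} {a b : Point m → Point m} → Involutive _≡_ a → Involutive _≡_ b →
  IsEquivalence (Holds (sameOrbit a b))
sameOrbit-isEquivalence a-inv b-inv =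
  isEquivalence-⇔ sameOrbit⇔Connected (Connected-isEquivalence a-inv b-inv)

Connected-agree : ∀ {m} {a b b′ : Point m → Point m} {p q} →
  (∀ r → Connected a b p r → b r ≡ b′ r) → Connected a b p q ⇔ Connected a b′ p q
Connected-agree {a = a} {b} {b′} {p} agree = mk⇔ (forward ε★) (backward ε★)
  where
  forward : ∀ {r q} → Connected a b p r → Connected a b r q → Connected a b′ r q
  forward p⇝r ε★                   = ε★
  forward p⇝r (along-a ◅ rest)     = along-a ◅ forward (p⇝r ◅◅ along-a ◅ ε★) rest
  forward {r} p⇝r (along-b ◅ rest) =
    subst (Step a b′ r) (sym (agree r p⇝r)) along-b ◅ forward (p⇝r ◅◅ along-b ◅ ε★) rest
  backward : ∀ {r q} → Connected a b p r → Connected a b′ r q → Connected a b p q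
  backward p⇝r ε★                   = p⇝r
  backward p⇝r (along-a ◅ rest)     = backward (p⇝r ◅◅ along-a ◅ ε★) rest
  backward {r} p⇝r (along-b ◅ rest) =
    backward (p⇝r ◅◅ subst (Step a b r) (agree r p⇝r) along-b ◅ ε★) rest

Connected-conjugate : ∀ {m} {a b a′ b′ π : Point m → Point m} → Involutive _≡_ π →
  (∀ p → a′ p ≡ π (a (π p))) → (∀ p → b′ p ≡ π (b (π p))) →
  ∀ {p q} → Connected a′ b′ p q ⇔ Connected a b (π p) (π q)
Connected-conjugate {a = a} {b} {a′} {b′} {π} π-inv a′≡ b′≡ = mk⇔
  (gmap π to-step)
  (λ path → subst₂ (Connected a′ b′) (π-inv _) (π-inv _) (gmap π from-step path))
  where
  to-step : ∀ {u v} → Step a′ b′ u v → Step a b (π u) (π v)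
  to-step {u} along-a = subst (Step a b (π u)) (sym (trans (cong π (a′≡ u)) (π-inv _))) along-a
  to-step {u} along-b = subst (Step a b (π u)) (sym (trans (cong π (b′≡ u)) (π-inv _))) along-b
  from-step : ∀ {u v} → Step a b u v → Step a′ b′ (π u) (π v)
  from-step {u} along-a = subst (Step a′ b′ (π u)) (trans (a′≡ (π u)) (cong (π ∘ a) (π-inv u))) along-a
  from-step {u} along-b = subst (Step a′ b′ (π u)) (trans (b′≡ (π u)) (cong (π ∘ b) (π-inv u))) along-b

Minimal : (Point m → Point m → Bool) → Point m → Bool
Minimal {m} R p = not (any (λ q → (key q <ᵇ key p) ∧ R p q) (allPoints m))

Transversal : (Point m → Point m → Bool) → (Point m → Bool) → Set
Transversal R P = ∀ x → ∑ₚ (λ y → χ (P y) * χ (R x y)) ≡ 1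

transversal-size : ∀ {R : Point m → Point m → Bool} {P Q} → Symmetric (Holds R) →
  Transversal R P → Transversal R Q → ∑ₚ (χ ∘ P) ≡ ∑ₚ (χ ∘ Q)
transversal-size {m} {R} {P} {Q} R-sym P-tr Q-tr = begin
  ∑ₚ (χ ∘ P)
    ≡⟨ ∑-cong (allPoints m) (λ x → sym (trans (cong (χ (P x) *_) (Q-tr x)) (*-identityʳ _))) ⟩
  ∑[ x ∈ allPoints m ] χ (P x) * ∑ₚ (λ y → χ (Q y) * χ (R x y))
    ≡⟨ ∑-cong (allPoints m) (λ x → sym (∑-*ˡ (allPoints m) (χ (P x)) _)) ⟩
  ∑[ x ∈ allPoints m ] ∑ₚ (λ y → χ (P x) * (χ (Q y) * χ (R x y)))
    ≡⟨ ∑-comm (allPoints m) (allPoints m) _ ⟩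
  ∑[ y ∈ allPoints m ] ∑ₚ (λ x → χ (P x) * (χ (Q y) * χ (R x y)))
    ≡⟨ ∑-cong (allPoints m) (λ y → ∑-cong (allPoints m) (λ x → swap x y)) ⟩
  ∑[ y ∈ allPoints m ] ∑ₚ (λ x → χ (Q y) * (χ (P x) * χ (R y x)))
    ≡⟨ ∑-cong (allPoints m) (λ y → ∑-*ˡ (allPoints m) (χ (Q y)) _) ⟩
  ∑[ y ∈ allPoints m ] χ (Q y) * ∑ₚ (λ x → χ (P x) * χ (R y x))
    ≡⟨ ∑-cong (allPoints m) (λ y → trans (cong (χ (Q y) *_) (P-tr y)) (*-identityʳ _)) ⟩
  ∑ₚ (χ ∘ Q) ∎
  where
  open ≡-Reasoning
  swap : ∀ x y → χ (P x) * (χ (Q y) * χ (R x y)) ≡ χ (Q y) * (χ (P x) * χ (R y x))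
  swap x y rewrite ≡-from-⇔ (R-sym {x} {y}) R-sym = x*[y*z]≡y*[x*z] (χ (P x)) (χ (Q y)) _

transversal-reindex : ∀ {m} {π : Point m → Point m} {R R′ : Point m → Point m → Bool} {P} →
  Involutive _≡_ π → (∀ x y → R′ x y ≡ R (π x) (π y)) → Transversal R P → Transversal R′ (P ∘ π)
transversal-reindex {m} {π} {R} {R′} {P} π-inv R′≡R P-tr x = begin
  ∑ₚ (λ y → χ (P (π y)) * χ (R′ x y))
    ≡⟨ ∑-cong (allPoints m) (λ y → cong (λ t → χ (P (π y)) * χ t) (R′≡R x y)) ⟩
  ∑ₚ (λ y → χ (P (π y)) * χ (R (π x) (π y)))
    ≡⟨ ∑ₚ-reindex π-inv (λ y → χ (P y) * χ (R (π x) y)) ⟩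
  ∑ₚ (λ y → χ (P y) * χ (R (π x) y))
    ≡⟨ P-tr (π x) ⟩
  1 ∎
  where open ≡-Reasoning

module _ {R : Point m → Point m → Bool} (R-equiv : IsEquivalence (Holds R)) where
  open IsEquivalence R-equiv renaming (sym to R-sym; trans to R-trans)

  minimal-least : ∀ {p q} → Minimal R p ≡ true → Holds R p q → key q ≮ key p
  minimal-least {p} {q} p-min pRq q<p = case trans (sym (not-injective p-min)) smaller-exists of λ ()
    where
    smaller-exists : any (λ r → (key r <ᵇ key p) ∧ R p r) (allPoints _) ≡ true
    smaller-exists = any-∈ _ (∈-allPoints q) (∧-true-intro (<⇒<ᵇ≡true q<p) pRq)

  minimal-unique : ∀ {p q} → Minimal R p ≡ true → Minimal R q ≡ true → Holds R p q → p ≡ q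
  minimal-unique {p} {q} p-min q-min pRq = key-injective p q
    (≤-antisym (≮⇒≥ (minimal-least p-min pRq)) (≮⇒≥ (minimal-least q-min (R-sym pRq))))

  minimal-exists : ∀ x → ∃[ q ] Holds R x q × Minimal R q ≡ true
  minimal-exists x = descend x (<-wellFounded (key x)) (IsEquivalence.refl R-equiv)
    where
    descend : ∀ c → Acc _<_ (key c) → Holds R x c → ∃[ q ] Holds R x q × Minimal R q ≡ true
    descend c (acc smaller) xRc with Minimal R c in c-min
    ... | true  = c , xRc , c-min
    ... | false with any-witness _ (allPoints m) (not-injective c-min)
    ...   | r , r<c∧cRr with ∧-true-elim _ r<c∧cRr
    ...     | r<c , cRr = descend r (smaller (<ᵇ≡true⇒< r<c)) (R-trans xRc cRr)

  minimal-transversal : Transversal R (Minimal R)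
  minimal-transversal x with minimal-exists x
  ... | q , xRq , q-min = begin
    ∑ₚ (λ y → χ (Minimal R y) * χ (R x y)) ≡⟨ ∑ₚ-δ q _ others ⟩
    χ (Minimal R q) * χ (R x q)            ≡⟨ cong₂ (λ s t → χ s * χ t) q-min xRq ⟩
    1                                      ∎
    where
    open ≡-Reasoning
    others : ∀ y → y ≢ q → χ (Minimal R y) * χ (R x y) ≡ 0
    others y y≢q =
      χ*χ-vanishes (λ y-min xRy → y≢q (minimal-unique y-min q-min (R-trans (R-sym xRy) xRq)))

orbits-∑ : ∀ (a b : Point m → Point m) → orbits a b ≡ ∑ₚ (χ ∘ isRep a b)
orbits-∑ {m} a b = trans (length-filter-∑ (λ p → isRep a b p ≟ᵇ true) (allPoints m))
  (∑-cong (allPoints m) (λ p → cong χ (does-≟true (isRep a b p))))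

orbits-conjugate : ∀ {m} {a b a′ b′ π : Point m → Point m} →
  Involutive _≡_ a → Involutive _≡_ b → Involutive _≡_ π →
  (∀ p → a′ p ≡ π (a (π p))) → (∀ p → b′ p ≡ π (b (π p))) → orbits a′ b′ ≡ orbits a b
orbits-conjugate {a = a} {b} {a′} {b′} {π} a-inv b-inv π-inv a′≡ b′≡ = begin
  orbits a′ b′            ≡⟨ orbits-∑ a′ b′ ⟩
  ∑ₚ (χ ∘ isRep a′ b′)    ≡⟨ transversal-size (IsEquivalence.sym R′-equiv) (minimal-transversal R′-equiv)
                                               conjugated-transversal ⟩
  ∑ₚ (χ ∘ isRep a b ∘ π)  ≡⟨ ∑ₚ-reindex {π = π} π-inv (χ ∘ isRep a b) ⟩
  ∑ₚ (χ ∘ isRep a b)      ≡⟨ orbits-∑ a b ⟨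
  orbits a b              ∎
  where
  open ≡-Reasoning
  R-equiv : IsEquivalence (Holds (sameOrbit a b))
  R-equiv = sameOrbit-isEquivalence a-inv b-inv
  R′⇔R : ∀ {p q} → Holds (sameOrbit a′ b′) p q ⇔ Holds (sameOrbit a b) (π p) (π q)
  R′⇔R = ⇔.trans sameOrbit⇔Connected
           (⇔.trans (Connected-conjugate π-inv a′≡ b′≡) (⇔.sym sameOrbit⇔Connected))
  R′-equiv : IsEquivalence (Holds (sameOrbit a′ b′))
  R′-equiv = isEquivalence-⇔ R′⇔R (On.isEquivalence π R-equiv)
  conjugated-transversal : Transversal (sameOrbit a′ b′) (isRep a b ∘ π)
  conjugated-transversal =
    transversal-reindex {π = π} {R = sameOrbit a b} {P = isRep a b} π-inv
      (λ x y → ≡-from-⇔ (Equivalence.to R′⇔R) (Equivalence.from R′⇔R)) (minimal-transversal R-equiv)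

OrbitWithin : (Point m → Point m → Bool) → (Point m → Bool) → Point m → Bool
OrbitWithin {m} R S p = all (λ q → not (R p q) ∨ S q) (allPoints m)

orbitWithin⇒ : ∀ {R S} {p q : Point m} → OrbitWithin R S p ≡ true → Holds R p q → S q ≡ true
orbitWithin⇒ {q = q} within pRq with all-∈ _ (∈-allPoints q) within
... | q-ok rewrite pRq = q-ok

orbitWithin-counterexample : ∀ {R S} {p : Point m} → OrbitWithin R S p ≡ false →
  ∃[ q ] Holds R p q × S q ≡ false
orbitWithin-counterexample {m} {R} {S} {p} h with all-counterexample _ (allPoints m) h
... | q , q-bad with R p q in pRq | S q in Sq | q-bad
...   | true  | false | _  = q , pRq , Sq
...   | false | _     | ()
...   | true  | true  | ()

OrbitWithin-cong : ∀ {R R′ S} {p p′ : Point m} → (∀ q → R p q ≡ R′ p′ q) →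
  OrbitWithin R S p ≡ OrbitWithin R′ S p′
OrbitWithin-cong {m} {S = S} R≡R′ = all-cong (λ q → cong (λ t → not t ∨ S q) (R≡R′ q)) (allPoints m)

Minimal-cong : ∀ {R R′} {p : Point m} → (∀ q → R p q ≡ R′ p q) → Minimal R p ≡ Minimal R′ p
Minimal-cong {m} {p = p} R≡R′ =
  cong not (any-cong (λ q → cong ((key q <ᵇ key p) ∧_) (R≡R′ q)) (allPoints m))

holds-shift : ∀ {R} {p q : Point m} → IsEquivalence (Holds R) → Holds R p q → ∀ z → R p z ≡ R q z
holds-shift R-equiv pRq z = ≡-from-⇔ (λ pRz → R-trans (R-sym pRq) pRz) (λ qRz → R-trans pRq qRz)
  where open IsEquivalence R-equiv renaming (sym to R-sym; trans to R-trans)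

ι₄-involutive : Involutive _≡_ ι₄
ι₄-involutive zero                   = refl
ι₄-involutive (suc zero)             = refl
ι₄-involutive (suc (suc zero))       = refl
ι₄-involutive (suc (suc (suc zero))) = refl

ε₄-involutive : Involutive _≡_ ε₄
ε₄-involutive zero                   = refl
ε₄-involutive (suc zero)             = refl
ε₄-involutive (suc (suc zero))       = refl
ε₄-involutive (suc (suc (suc zero))) = refl

swap13-involutive : Involutive _≡_ swap13
swap13-involutive zero                   = refl
swap13-involutive (suc zero)             = refl
swap13-involutive (suc (suc zero))       = refl
swap13-involutive (suc (suc (suc zero))) = refl

ι₄-fixpoint-free : ∀ c → ι₄ c ≢ c
ι₄-fixpoint-free zero                   ()
ι₄-fixpoint-free (suc zero)             ()
ι₄-fixpoint-free (suc (suc zero))       ()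
ι₄-fixpoint-free (suc (suc (suc zero))) ()

ι₄-injective : ∀ {c d} → ι₄ c ≡ ι₄ d → c ≡ d
ι₄-injective {c} {d} eq = trans (sym (ι₄-involutive c)) (trans (cong ι₄ eq) (ι₄-involutive d))

ι₄-conjugate-ε₄ : ∀ c → ι₄ c ≡ swap13 (ε₄ (swap13 c))
ι₄-conjugate-ε₄ zero                   = refl
ι₄-conjugate-ε₄ (suc zero)             = refl
ι₄-conjugate-ε₄ (suc (suc zero))       = refl
ι₄-conjugate-ε₄ (suc (suc (suc zero))) = refl

ι₄-pairs-cover : ∀ a b c → b ≢ a → b ≢ ι₄ a → c ≡ a ⊎ c ≡ ι₄ a ⊎ c ≡ b ⊎ c ≡ ι₄ b
ι₄-pairs-cover a b c b≢a b≢ιa = [ ⊥-elim ∘ b≢a , [ ⊥-elim ∘ b≢ιa , id ]′ ]′ (by-inspection a b c)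
  where
  by-inspection : ∀ a b c → b ≡ a ⊎ b ≡ ι₄ a ⊎ c ≡ a ⊎ c ≡ ι₄ a ⊎ c ≡ b ⊎ c ≡ ι₄ b
  by-inspection = from-yes (all? λ a → all? λ b → all? λ c →
    b ≟ a ⊎-dec b ≟ ι₄ a ⊎-dec c ≟ a ⊎-dec c ≟ ι₄ a ⊎-dec c ≟ b ⊎-dec c ≟ ι₄ b)

ι-involutive : Involutive _≡_ (ι {m})
ι-involutive (i , c) = cong (i ,_) (ι₄-involutive c)

does-∈?-lookup : ∀ (i : Fin m) F → does (i ∈? F) ≡ lookup F i
does-∈?-lookup zero    (true  ∷ F) = refl
does-∈?-lookup zero    (false ∷ F) = refl
does-∈?-lookup (suc i) (_ ∷ F)     = does-∈?-lookup i F

ε[]-involutive : ∀ (F : Subset m) → Involutive _≡_ ε[ F ]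
ε[]-involutive F (i , c) with does (i ∈? F) in i∈F
... | true  rewrite i∈F = cong (i ,_) (ε₄-involutive c)
... | false rewrite i∈F = cong (i ,_) (ι₄-involutive c)

ε[]-edge : ∀ (F : Subset m) p → proj₁ (ε[ F ] p) ≡ proj₁ p
ε[]-edge F (i , c) with does (i ∈? F)
... | true  = refl
... | false = refl

π[]-involutive : ∀ (A : Subset m) → Involutive _≡_ π[ A ]
π[]-involutive A (i , c) with does (i ∈? A) in i∈A
... | true  rewrite i∈A = cong (i ,_) (swap13-involutive c)
... | false rewrite i∈A = refl

ε[insertAt]-self : ∀ (F : Subset m) e b c →
  ε[ insertAt F e b ] (e , c) ≡ (if b then ε (e , c) else ι (e , c))
ε[insertAt]-self F e b c =
  cong (λ t → if t then ε (e , c) else ι (e , c)) (trans (does-∈?-lookup e _) (insertAt-lookup F e b))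

ε[insertAt]-punchIn : ∀ (F : Subset m) e b y → ε[ insertAt F e b ] (punchInₚ e y) ≡ punchInₚ e (ε[ F ] y)
ε[insertAt]-punchIn F e b (i , c)
  rewrite does-∈?-lookup (punchIn e i) (insertAt F e b) | insertAt-punchIn F e b i
        | sym (does-∈?-lookup i F)
  with does (i ∈? F)
... | true  = refl
... | false = refl

π[⁅⁆]-self : ∀ (e : Fin m) c → π[ ⁅ e ⁆ ] (e , c) ≡ (e , swap13 c)
π[⁅⁆]-self e c rewrite dec-true (e ∈? ⁅ e ⁆) (x∈⁅x⁆ e) = refl

π[⁅⁆]-off : ∀ (e : Fin m) {p} → e ≢ proj₁ p → π[ ⁅ e ⁆ ] p ≡ p
π[⁅⁆]-off e {i , c} e≢i rewrite dec-false (i ∈? ⁅ e ⁆) (x≢y⇒x∉⁅y⁆ (e≢i ∘ sym)) = refl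

-- ν pairs a₀ with a corner off e, ι₄ a₀ with a₁ and ι₄ a₁ with a₂; since ν is a fixpoint-free
-- involution, a₁ lies in the other ι₄-pair than a₀, and then no corner is left for a₂.
boundary-walk-leaves-edge : ∀ {M} (G : Ribbon M) → IsRibbon G → ∀ {x e a₀ a₁ a₂} → proj₁ x ≢ e →
  ν G x ≡ (e , a₀) → ν G (e , ι₄ a₀) ≡ (e , a₁) → ν G (e , ι₄ a₁) ≡ (e , a₂) → ⊥
boundary-walk-leaves-edge G (ν-involutive , ν-fixpoint-free) {x} {e} {a₀} {a₁} {a₂} x-off N₀ N₁ N₂ =
  third-corner N₂ (ι₄-pairs-cover a₀ a₁ a₂ a₁≢a₀ a₁≢ιa₀)
  where
  partner : ∀ {p q} → ν G p ≡ q → ν G q ≡ p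
  partner {p} νp≡q = trans (cong (ν G) (sym νp≡q)) (ν-involutive p)
  off : ∀ c → (e , c) ≢ x
  off c eq = x-off (cong proj₁ (sym eq))
  a₁≢a₀ : a₁ ≢ a₀
  a₁≢a₀ refl = off (ι₄ a₀) (trans (sym (partner N₁)) (partner N₀))
  a₁≢ιa₀ : a₁ ≢ ι₄ a₀
  a₁≢ιa₀ refl = ν-fixpoint-free _ N₁
  third-corner : ∀ {a} → ν G (e , ι₄ a₁) ≡ (e , a) → a ≡ a₀ ⊎ a ≡ ι₄ a₀ ⊎ a ≡ a₁ ⊎ a ≡ ι₄ a₁ → ⊥
  third-corner N (inj₁ refl)               = off (ι₄ a₁) (trans (sym (partner N)) (partner N₀))
  third-corner N (inj₂ (inj₁ refl))        =
    ι₄-fixpoint-free a₁ (sym (cong proj₂ (trans (sym N₁) (partner N))))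
  third-corner N (inj₂ (inj₂ (inj₁ refl))) =
    a₁≢a₀ (ι₄-injective (cong proj₂ (trans (sym (partner N)) (partner N₁))))
  third-corner N (inj₂ (inj₂ (inj₂ refl))) = ν-fixpoint-free _ N

-- The edge e is not in the spanning subgraph, so εᴳ acts on the corners of e as ι: an orbit of G
-- either contains corners ↑ y of G \ e, or lies entirely on e and becomes an isolated vertex.
module Deletion {m} (G : Ribbon (suc m)) (G-valid : IsRibbon G) (e : Fin (suc m)) (F′ : Subset m) where

  νᴳ εᴳ : Point (suc m) → Point (suc m)
  νᴳ = ν G
  εᴳ = ε[ insertAt F′ e false ]

  νᵈ εᵈ : Point m → Point m
  νᵈ = ν (G \\ e)
  εᵈ = ε[ F′ ]

  ↑ : Point m → Point (suc m)
  ↑ = punchInₚ e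

  OnE : Point (suc m) → Set
  OnE p = e ≡ proj₁ p

  νᴳ-involutive : Involutive _≡_ νᴳ
  νᴳ-involutive = proj₁ G-valid

  ↑-off-e : ∀ y → ¬ OnE (↑ y)
  ↑-off-e (i , c) e≡ = punchInᵢ≢i e i (sym e≡)

  ↑-injective : ∀ {y y′} → ↑ y ≡ ↑ y′ → y ≡ y′
  ↑-injective {i , c} {j , d} eq = cong₂ _,_ (punchIn-injective e i j (cong proj₁ eq)) (cong proj₂ eq)

  ↑-punchOut : ∀ {i} (e≢i : e ≢ i) c → ↑ (punchOut e≢i , c) ≡ (i , c)
  ↑-punchOut e≢i c = cong (_, c) (punchIn-punchOut e≢i)

  at-e : ∀ {p} → OnE p → p ≡ (e , proj₂ p)
  at-e {p} on = cong (_, proj₂ p) (sym on)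

  onEdge⇒OnE : ∀ p → onEdge e p ≡ true → OnE p
  onEdge⇒OnE (i , c) = does≡true⇒ (e ≟ i)

  εᴳ-on-e : ∀ {p} → OnE p → εᴳ p ≡ ι p
  εᴳ-on-e {i , c} refl = ε[insertAt]-self F′ e false c

  εᴳ-↑ : ∀ y → εᴳ (↑ y) ≡ ↑ (εᵈ y)
  εᴳ-↑ = ε[insertAt]-punchIn F′ e false

  exit-off-e : ∀ fuel d p → ¬ OnE p → ↑ (exit G e fuel d p) ≡ p
  exit-off-e fuel d (i , c) off with e ≟ i
  ... | yes on  = ⊥-elim (off on)
  ... | no e≢i = ↑-punchOut e≢i c

  exit-on-e : ∀ fuel d p → OnE p → exit G e (suc fuel) d p ≡ exit G e fuel d (νᴳ (ι p))
  exit-on-e fuel d (i , c) on with e ≟ i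
  ... | yes _   = refl
  ... | no e≢i = ⊥-elim (e≢i on)

  exit-connected : ∀ fuel d p {x} → Connected νᴳ εᴳ x p → Connected νᴳ εᴳ x (↑ d) →
    Connected νᴳ εᴳ x (↑ (exit G e fuel d p))
  exit-connected fuel d (i , c) x⇝p x⇝d with e ≟ i
  ... | no e≢i = subst (Connected νᴳ εᴳ _) (sym (↑-punchOut e≢i c)) x⇝p
  exit-connected zero       d (i , c) x⇝p x⇝d | yes _  = x⇝d
  exit-connected (suc fuel) d (i , c) x⇝p x⇝d | yes on =
    exit-connected fuel d (νᴳ (ι (i , c))) (x⇝p ◅◅ along-ι ◅ along-a ◅ ε★) x⇝d
    where
    along-ι : Step νᴳ εᴳ (i , c) (ι (i , c))
    along-ι = subst (Step νᴳ εᴳ (i , c)) (εᴳ-on-e on) along-b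

  lift-step : ∀ {y y′} → Step νᵈ εᵈ y y′ → Connected νᴳ εᴳ (↑ y) (↑ y′)
  lift-step {y} along-a = exit-connected 3 y (νᴳ (↑ y)) (along-a ◅ ε★) ε★
  lift-step {y} along-b = subst (Step νᴳ εᴳ (↑ y)) (εᴳ-↑ y) along-b ◅ ε★

  q₀ q₁ q₂ : Point m → Point (suc m)
  q₀ w = νᴳ (↑ w)
  q₁ w = νᴳ (ι (q₀ w))
  q₂ w = νᴳ (ι (q₁ w))

  q₂-off-e : ∀ {w} → OnE (q₀ w) → OnE (q₁ w) → ¬ OnE (q₂ w)
  q₂-off-e {w} on₀ on₁ on₂ = boundary-walk-leaves-edge G G-valid (↑-off-e w ∘ sym) (at-e on₀)
    (trans (cong (λ i → νᴳ (i , ι₄ (proj₂ (q₀ w)))) on₀) (at-e on₁))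
    (trans (cong (λ i → νᴳ (i , ι₄ (proj₂ (q₁ w)))) on₁) (at-e on₂))

  νᵈ-from-q₀ : ∀ {w} → ¬ OnE (q₀ w) → ↑ (νᵈ w) ≡ q₀ w
  νᵈ-from-q₀ {w} off₀ = exit-off-e 3 w (q₀ w) off₀

  νᵈ-from-q₁ : ∀ {w} → OnE (q₀ w) → ¬ OnE (q₁ w) → ↑ (νᵈ w) ≡ q₁ w
  νᵈ-from-q₁ {w} on₀ off₁ = trans (cong ↑ (exit-on-e 2 w (q₀ w) on₀)) (exit-off-e 2 w (q₁ w) off₁)

  νᵈ-from-q₂ : ∀ {w} → OnE (q₀ w) → OnE (q₁ w) → ↑ (νᵈ w) ≡ q₂ w
  νᵈ-from-q₂ {w} on₀ on₁ =
    trans (cong ↑ (trans (exit-on-e 2 w (q₀ w) on₀) (exit-on-e 1 w (q₁ w) on₁)))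
          (exit-off-e 1 w (q₂ w) (q₂-off-e on₀ on₁))

  -- The corners that the boundary of G visits from ↑ w on, until it reaches ↑ (νᵈ w).
  data Trail (w : Point m) : Point (suc m) → Set where
    start  : Trail w (↑ w)
    enter₀ : OnE (q₀ w) → Trail w (q₀ w)
    cross₀ : OnE (q₀ w) → Trail w (ι (q₀ w))
    enter₁ : OnE (q₀ w) → OnE (q₁ w) → Trail w (q₁ w)
    cross₁ : OnE (q₀ w) → OnE (q₁ w) → Trail w (ι (q₁ w))

  Reached : Point m → Point (suc m) → Set
  Reached y x = ∃[ w ] Connected νᵈ εᵈ y w × Trail w x

  restart : ∀ {y w w′ x} → Connected νᵈ εᵈ y w → Step νᵈ εᵈ w w′ → ↑ w′ ≡ x → Reached y x
  restart {w′ = w′} y⇝w s ↑w′≡x = w′ , y⇝w ◅◅ s ◅ ε★ , subst (Trail w′) ↑w′≡x start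

  stay : ∀ {y w x x′} → Connected νᵈ εᵈ y w → Trail w x → x ≡ x′ → Reached y x′
  stay {w = w} y⇝w t refl = w , y⇝w , t

  reached-step : ∀ {y x x′} → Reached y x → Step νᴳ εᴳ x x′ → Reached y x′
  reached-step (w , y⇝w , start) along-a with e ≟ proj₁ (q₀ w)
  ... | yes on₀ = stay y⇝w (enter₀ on₀) refl
  ... | no off₀ = restart y⇝w along-a (νᵈ-from-q₀ off₀)
  reached-step (w , y⇝w , enter₀ on₀) along-a = stay y⇝w start (sym (νᴳ-involutive (↑ w)))
  reached-step (w , y⇝w , cross₀ on₀) along-a with e ≟ proj₁ (q₁ w)
  ... | yes on₁ = stay y⇝w (enter₁ on₀ on₁) refl
  ... | no off₁ = restart y⇝w along-a (νᵈ-from-q₁ on₀ off₁)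
  reached-step (w , y⇝w , enter₁ on₀ on₁) along-a = stay y⇝w (cross₀ on₀) (sym (νᴳ-involutive _))
  reached-step (w , y⇝w , cross₁ on₀ on₁) along-a = restart y⇝w along-a (νᵈ-from-q₂ on₀ on₁)
  reached-step (w , y⇝w , start)          along-b = restart y⇝w along-b (sym (εᴳ-↑ w))
  reached-step (w , y⇝w , enter₀ on₀)     along-b = stay y⇝w (cross₀ on₀) (sym (εᴳ-on-e on₀))
  reached-step (w , y⇝w , cross₀ on₀)     along-b =
    stay y⇝w (enter₀ on₀) (sym (trans (εᴳ-on-e on₀) (ι-involutive _)))
  reached-step (w , y⇝w , enter₁ on₀ on₁) along-b = stay y⇝w (cross₁ on₀ on₁) (sym (εᴳ-on-e on₁))
  reached-step (w , y⇝w , cross₁ on₀ on₁) along-b =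
    stay y⇝w (enter₁ on₀ on₁) (sym (trans (εᴳ-on-e on₁) (ι-involutive _)))

  reached-closed : ∀ {y x x′} → Reached y x → Connected νᴳ εᴳ x x′ → Reached y x′
  reached-closed r ε★       = r
  reached-closed r (s ◅ ss) = reached-closed (reached-step r s) ss

  trail-↑ : ∀ {w x y} → Trail w x → x ≡ ↑ y → w ≡ y
  trail-↑         start            eq = ↑-injective eq
  trail-↑ {y = y} (enter₀ on₀)     eq = ⊥-elim (↑-off-e y (trans on₀ (cong proj₁ eq)))
  trail-↑ {y = y} (cross₀ on₀)     eq = ⊥-elim (↑-off-e y (trans on₀ (cong proj₁ eq)))
  trail-↑ {y = y} (enter₁ on₀ on₁) eq = ⊥-elim (↑-off-e y (trans on₁ (cong proj₁ eq)))
  trail-↑ {y = y} (cross₁ on₀ on₁) eq = ⊥-elim (↑-off-e y (trans on₁ (cong proj₁ eq)))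

  Connected-↑ : ∀ {y y′} → Connected νᵈ εᵈ y y′ ⇔ Connected νᴳ εᴳ (↑ y) (↑ y′)
  Connected-↑ {y} = mk⇔ (kleisliStar ↑ lift-step) lower
    where
    lower : ∀ {y′} → Connected νᴳ εᴳ (↑ y) (↑ y′) → Connected νᵈ εᵈ y y′
    lower path with reached-closed (y , ε★ , start) path
    ... | w , y⇝w , t = subst (Connected νᵈ εᵈ y) (trail-↑ t refl) y⇝w

  R Rᵈ : Point _ → Point _ → Bool
  R  = sameOrbit νᴳ εᴳ
  Rᵈ = sameOrbit νᵈ εᵈ

  R-equiv : IsEquivalence (Holds R)
  R-equiv = sameOrbit-isEquivalence νᴳ-involutive (ε[]-involutive (insertAt F′ e false))

  Rᵈ⇔R : ∀ {y y′} → Holds Rᵈ y y′ ⇔ Holds R (↑ y) (↑ y′)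
  Rᵈ⇔R = ⇔.trans sameOrbit⇔Connected (⇔.trans Connected-↑ (⇔.sym sameOrbit⇔Connected))

  Rᵈ-equiv : IsEquivalence (Holds Rᵈ)
  Rᵈ-equiv = isEquivalence-⇔ Rᵈ⇔R (On.isEquivalence ↑ R-equiv)

  Rᵈ≡R : ∀ y y′ → Rᵈ y y′ ≡ R (↑ y) (↑ y′)
  Rᵈ≡R y y′ = ≡-from-⇔ (Equivalence.to Rᵈ⇔R) (Equivalence.from Rᵈ⇔R)

  Inside : (Point (suc m) → Point (suc m)) → Point (suc m) → Bool
  Inside b = OrbitWithin (sameOrbit νᴳ b) (onEdge e)

  Inside-invariant : ∀ {p q} → Holds R p q → Inside εᴳ q ≡ Inside εᴳ p
  Inside-invariant {p} {q} pRq = OrbitWithin-cong {R = R} {R′ = R} {S = onEdge e} {p = q} {p′ = p}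
    (λ z → sym (holds-shift {R = R} R-equiv pRq z))

  Isolated : Point (suc m) → Bool
  Isolated p = isRep νᴳ εᴳ p ∧ Inside εᴳ p

  -- A transversal of the orbits of G: representatives of G \ e off e, isolated orbits on e.
  rep-at : ∀ {i} → Dec (e ≡ i) → Fin 4 → Bool
  rep-at {i} (yes _)  c = Isolated (i , c)
  rep-at     (no e≢i) c = isRep νᵈ εᵈ (punchOut e≢i , c)

  rep : Point (suc m) → Bool
  rep (i , c) = rep-at (e ≟ i) c

  rep-e : ∀ c → rep (e , c) ≡ Isolated (e , c)
  rep-e c = cong (λ d → rep-at d c) (proj₂ (dec-yes (e ≟ e) refl))

  rep-↑ : ∀ y → rep (↑ y) ≡ isRep νᵈ εᵈ y
  rep-↑ (i , c) = trans (cong (λ d → rep-at d c) (dec-no (e ≟ punchIn e i) (punchInᵢ≢i e i ∘ sym)))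
                        (cong (λ j → isRep νᵈ εᵈ (j , c)) (punchOut-punchIn e))

  rep-inside : ∀ {x} → Inside εᴳ x ≡ true → ∀ y → Holds R x y → rep y ≡ isRep νᴳ εᴳ y
  rep-inside {x} x-inside y xRy = begin
    rep y                        ≡⟨ cong rep y≡e ⟩
    rep (e , proj₂ y)            ≡⟨ rep-e (proj₂ y) ⟩
    Isolated (e , proj₂ y)       ≡⟨ cong Isolated (sym y≡e) ⟩
    isRep νᴳ εᴳ y ∧ Inside εᴳ y  ≡⟨ cong (isRep νᴳ εᴳ y ∧_) (trans (Inside-invariant xRy) x-inside) ⟩
    isRep νᴳ εᴳ y ∧ true         ≡⟨ ∧-identityʳ _ ⟩
    isRep νᴳ εᴳ y                ∎
    where
    open ≡-Reasoning
    y≡e : y ≡ (e , proj₂ y)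
    y≡e = at-e (onEdge⇒OnE y (orbitWithin⇒ {R = R} {S = onEdge e} x-inside xRy))

  rep-outside : ∀ {x y₀} → Inside εᴳ x ≡ false → Holds R x (↑ y₀) →
    ∑ₚ (λ y → χ (rep y) * χ (R x y)) ≡ 1
  rep-outside {x} {y₀} x-outside xRy₀ = begin
    ∑ₚ (λ y → χ (rep y) * χ (R x y))
      ≡⟨ ∑ₚ-punchIn e (λ y → χ (rep y) * χ (R x y)) ⟩
    ∑ᶜ e (λ y → χ (rep y) * χ (R x y)) + ∑ₚ (λ y → χ (rep (↑ y)) * χ (R x (↑ y)))
      ≡⟨ cong₂ _+_ (∑-zero (allFin' 4) corner-vanishes) (∑-cong (allPoints m) descend) ⟩
    ∑ₚ (λ y → χ (isRep νᵈ εᵈ y) * χ (Rᵈ y₀ y))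
      ≡⟨ minimal-transversal Rᵈ-equiv y₀ ⟩
    1 ∎
    where
    open ≡-Reasoning
    corner-vanishes : ∀ c → χ (rep (e , c)) * χ (R x (e , c)) ≡ 0
    corner-vanishes c = χ*χ-vanishes λ rep-true xRe → case (begin
      true                                    ≡⟨ rep-true ⟨
      rep (e , c)                             ≡⟨ rep-e c ⟩
      isRep νᴳ εᴳ (e , c) ∧ Inside εᴳ (e , c)
        ≡⟨ cong (isRep νᴳ εᴳ (e , c) ∧_) (trans (Inside-invariant xRe) x-outside) ⟩
      isRep νᴳ εᴳ (e , c) ∧ false             ≡⟨ ∧-zeroʳ _ ⟩
      false                                   ∎) of λ ()
    descend : ∀ y → χ (rep (↑ y)) * χ (R x (↑ y)) ≡ χ (isRep νᵈ εᵈ y) * χ (Rᵈ y₀ y)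
    descend y = cong₂ (λ s t → χ s * χ t) (rep-↑ y)
                      (trans (holds-shift {R = R} R-equiv xRy₀ (↑ y)) (sym (Rᵈ≡R y₀ y)))

  rep-transversal : Transversal R rep
  rep-transversal x = by-inside (Inside εᴳ x) refl
    where
    by-inside : ∀ b → Inside εᴳ x ≡ b → ∑ₚ (λ y → χ (rep y) * χ (R x y)) ≡ 1
    by-inside true x-inside =
      trans (∑-cong (allPoints (suc m)) (λ y → χ-*-cong (R x y) (rep-inside x-inside y)))
            (minimal-transversal R-equiv x)
    by-inside false x-outside = leaving (orbitWithin-counterexample {R = R} {S = onEdge e} x-outside)
      where
      leaving : ∃[ q ] Holds R x q × onEdge e q ≡ false → ∑ₚ (λ y → χ (rep y) * χ (R x y)) ≡ 1
      leaving ((i , c) , xRq , q-off) =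
        rep-outside x-outside (subst (Holds R x) (sym (↑-punchOut e≢i c)) xRq)
        where
        e≢i : e ≢ i
        e≢i e≡i = case trans (sym q-off) (dec-true (e ≟ i) e≡i) of λ ()

  orbits-deletion : orbits νᴳ εᴳ ≡ ∑ᶜ e (χ ∘ Isolated) + orbits νᵈ εᵈ
  orbits-deletion = begin
    orbits νᴳ εᴳ
      ≡⟨ orbits-∑ νᴳ εᴳ ⟩
    ∑ₚ (χ ∘ isRep νᴳ εᴳ)
      ≡⟨ transversal-size {R = R} {P = isRep νᴳ εᴳ} {Q = rep}
           (IsEquivalence.sym R-equiv) (minimal-transversal R-equiv) rep-transversal ⟩
    ∑ₚ (χ ∘ rep)
      ≡⟨ ∑ₚ-punchIn e (χ ∘ rep) ⟩
    ∑ᶜ e (χ ∘ rep) + ∑ₚ (χ ∘ rep ∘ ↑)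
      ≡⟨ cong₂ _+_ (∑-cong (allFin' 4) (cong χ ∘ rep-e)) (∑-cong (allPoints m) (cong χ ∘ rep-↑)) ⟩
    ∑ᶜ e (χ ∘ Isolated) + ∑ₚ (χ ∘ isRep νᵈ εᵈ)
      ≡⟨ cong (∑ᶜ e (χ ∘ Isolated) +_) (orbits-∑ νᵈ εᵈ) ⟨
    ∑ᶜ e (χ ∘ Isolated) + orbits νᵈ εᵈ ∎
    where open ≡-Reasoning

  sameOrbit-agree : ∀ {b b′} → (∀ r → OnE r → b r ≡ b′ r) → ∀ {p} → Inside b p ≡ true →
    ∀ q → sameOrbit νᴳ b p q ≡ sameOrbit νᴳ b′ p q
  sameOrbit-agree {b} {b′} b≡b′ {p} inside q = ≡-from-⇔ (Equivalence.to same) (Equivalence.from same)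
    where
    agree : ∀ r → Connected νᴳ b p r → b r ≡ b′ r
    agree r p⇝r =
      b≡b′ r (onEdge⇒OnE r (orbitWithin⇒ {R = sameOrbit νᴳ b} {S = onEdge e} inside
                                         (reach-complete p⇝r)))
    same : Holds (sameOrbit νᴳ b) p q ⇔ Holds (sameOrbit νᴳ b′) p q
    same = ⇔.trans sameOrbit⇔Connected (⇔.trans (Connected-agree agree) (⇔.sym sameOrbit⇔Connected))

  Isolated-ι : ∀ p → isRep νᴳ ι p ∧ Inside ι p ≡ Isolated p
  Isolated-ι p = by-inside (Inside εᴳ p) refl (Inside ι p) refl
    where
    by-inside : ∀ bε → Inside εᴳ p ≡ bε → ∀ bι → Inside ι p ≡ bι → isRep νᴳ ι p ∧ Inside ι p ≡ Isolated p
    by-inside true inside-ε _ _ =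
      cong₂ _∧_ (Minimal-cong {R = sameOrbit νᴳ ι} {R′ = R} agree)
                (OrbitWithin-cong {R = sameOrbit νᴳ ι} {R′ = R} {S = onEdge e} agree)
      where
      agree : ∀ q → sameOrbit νᴳ ι p q ≡ R p q
      agree q = sym (sameOrbit-agree {εᴳ} {ι} (λ r → εᴳ-on-e) inside-ε q)
    by-inside false inside-ε true inside-ι = case trans (sym inside-ι) (trans leaves inside-ε) of λ ()
      where
      leaves : Inside ι p ≡ Inside εᴳ p
      leaves = OrbitWithin-cong {R = sameOrbit νᴳ ι} {R′ = R} {S = onEdge e}
                 (sameOrbit-agree {ι} {εᴳ} (λ r on → sym (εᴳ-on-e on)) inside-ι)
    by-inside false inside-ε false inside-ι = begin
      isRep νᴳ ι p ∧ Inside ι p  ≡⟨ cong (isRep νᴳ ι p ∧_) inside-ι ⟩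
      isRep νᴳ ι p ∧ false       ≡⟨ ∧-zeroʳ _ ⟩
      false                      ≡⟨ ∧-zeroʳ _ ⟨
      isRep νᴳ εᴳ p ∧ false      ≡⟨ cong (isRep νᴳ εᴳ p ∧_) inside-ε ⟨
      Isolated p                 ∎
      where open ≡-Reasoning

  newIsolated-≡ : newIsolated G e ≡ ∑ᶜ e (χ ∘ Isolated)
  newIsolated-≡ = begin
    newIsolated G e
      ≡⟨ length-filter-∑ (λ p → N p ≟ᵇ true) (allPoints (suc m)) ⟩
    ∑ₚ (λ p → χ (does (N p ≟ᵇ true)))
      ≡⟨ ∑-cong (allPoints (suc m)) (λ p → cong χ (does-≟true (N p))) ⟩
    ∑ₚ (χ ∘ N)
      ≡⟨ ∑ₚ-punchIn e (χ ∘ N) ⟩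
    ∑ᶜ e (χ ∘ N) + ∑ₚ (χ ∘ N ∘ ↑)
      ≡⟨ cong₂ _+_ (∑-cong (allFin' 4) on-e) (∑-zero (allPoints m) off-e) ⟩
    ∑ᶜ e (χ ∘ Isolated) + 0
      ≡⟨ +-identityʳ _ ⟩
    ∑ᶜ e (χ ∘ Isolated) ∎
    where
    open ≡-Reasoning
    N : Point (suc m) → Bool
    N p = onEdge e p ∧ isRep νᴳ ι p ∧ Inside ι p
    on-e : ∀ c → χ (N (e , c)) ≡ χ (Isolated (e , c))
    on-e c = trans (cong (λ t → χ (t ∧ isRep νᴳ ι (e , c) ∧ Inside ι (e , c))) (dec-true (e ≟ e) refl))
                   (cong χ (Isolated-ι (e , c)))
    off-e : ∀ y → χ (N (↑ y)) ≡ 0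
    off-e y@(i , c) = cong (λ t → χ (t ∧ isRep νᴳ ι (↑ y) ∧ Inside ι (↑ y)))
                           (dec-false (e ≟ punchIn e i) (punchInᵢ≢i e i ∘ sym))

  bc-deletion : bc G (insertAt F′ e false) ≡ bc (G \\ e) F′
  bc-deletion = begin
    orbits νᴳ εᴳ + iso G                         ≡⟨ cong (_+ iso G) orbits-deletion ⟩
    (isolated + orbits νᵈ εᵈ) + iso G            ≡⟨ cong (_+ iso G) (+-comm isolated (orbits νᵈ εᵈ)) ⟩
    (orbits νᵈ εᵈ + isolated) + iso G            ≡⟨ +-assoc (orbits νᵈ εᵈ) isolated (iso G) ⟩
    orbits νᵈ εᵈ + (isolated + iso G)            ≡⟨ cong (orbits νᵈ εᵈ +_) (+-comm isolated (iso G)) ⟩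
    orbits νᵈ εᵈ + (iso G + isolated)            ≡⟨ cong (λ k → orbits νᵈ εᵈ + (iso G + k)) newIsolated-≡ ⟨
    orbits νᵈ εᵈ + (iso G + newIsolated G e)     ∎
    where
    open ≡-Reasoning
    isolated : ℕ
    isolated = ∑ᶜ e (χ ∘ Isolated)

partialDual-valid : ∀ (G : Ribbon m) A → IsRibbon G → IsRibbon (G ^δ A)
partialDual-valid G A (ν-involutive , ν-fixpoint-free) = involutive , fixpoint-free
  where
  open ≡-Reasoning
  π = π[ A ]
  involutive : ∀ p → π (ν G (π (π (ν G (π p))))) ≡ p
  involutive p = begin
    π (ν G (π (π (ν G (π p)))))  ≡⟨ cong (π ∘ ν G) (π[]-involutive A (ν G (π p))) ⟩
    π (ν G (ν G (π p)))          ≡⟨ cong π (ν-involutive (π p)) ⟩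
    π (π p)                      ≡⟨ π[]-involutive A p ⟩
    p                            ∎
  fixpoint-free : ∀ p → π (ν G (π p)) ≢ p
  fixpoint-free p fixed = ν-fixpoint-free (π p) (trans (sym (π[]-involutive A (ν G (π p)))) (cong π fixed))

ε[]-partialDual : ∀ (F : Subset m) e p →
  ε[ insertAt F e false ] p ≡ π[ ⁅ e ⁆ ] (ε[ insertAt F e true ] (π[ ⁅ e ⁆ ] p))
ε[]-partialDual F e (i , c) with e ≟ i
... | yes refl = begin
  ε[ insertAt F e false ] (e , c)
    ≡⟨ ε[insertAt]-self F e false c ⟩
  (e , ι₄ c)
    ≡⟨ cong (e ,_) (ι₄-conjugate-ε₄ c) ⟩
  (e , swap13 (ε₄ (swap13 c)))
    ≡⟨ π[⁅⁆]-self e (ε₄ (swap13 c)) ⟨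
  π[ ⁅ e ⁆ ] (e , ε₄ (swap13 c))
    ≡⟨ cong π[ ⁅ e ⁆ ] (ε[insertAt]-self F e true (swap13 c)) ⟨
  π[ ⁅ e ⁆ ] (ε[ insertAt F e true ] (e , swap13 c))
    ≡⟨ cong (π[ ⁅ e ⁆ ] ∘ ε[ insertAt F e true ]) (π[⁅⁆]-self e c) ⟨
  π[ ⁅ e ⁆ ] (ε[ insertAt F e true ] (π[ ⁅ e ⁆ ] (e , c))) ∎
  where open ≡-Reasoning
... | no e≢i = begin
  ε[ insertAt F e false ] (i , c)
    ≡⟨ cong ε[ insertAt F e false ] i,c≡↑y ⟩
  ε[ insertAt F e false ] (punchInₚ e y)
    ≡⟨ ε[insertAt]-punchIn F e false y ⟩
  punchInₚ e (ε[ F ] y)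
    ≡⟨ ε[insertAt]-punchIn F e true y ⟨
  ε[ insertAt F e true ] (punchInₚ e y)
    ≡⟨ cong ε[ insertAt F e true ] i,c≡↑y ⟨
  ε[ insertAt F e true ] (i , c)
    ≡⟨ π[⁅⁆]-off e (λ e≡ → e≢i (trans e≡ (ε[]-edge _ (i , c)))) ⟨
  π[ ⁅ e ⁆ ] (ε[ insertAt F e true ] (i , c))
    ≡⟨ cong (π[ ⁅ e ⁆ ] ∘ ε[ insertAt F e true ]) (π[⁅⁆]-off e e≢i) ⟨
  π[ ⁅ e ⁆ ] (ε[ insertAt F e true ] (π[ ⁅ e ⁆ ] (i , c))) ∎
  where
  open ≡-Reasoning
  y : Point _
  y = punchOut e≢i , c
  i,c≡↑y : (i , c) ≡ punchInₚ e y
  i,c≡↑y = cong (_, c) (sym (punchIn-punchOut e≢i))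

orbits-partialDual : ∀ (G : Ribbon (suc m)) → IsRibbon G → ∀ e F →
  orbits (ν (G ^δ ⁅ e ⁆)) ε[ insertAt F e false ] ≡ orbits (ν G) ε[ insertAt F e true ]
orbits-partialDual G G-valid e F =
  orbits-conjugate {a = ν G} {ε[ insertAt F e true ]} {ν (G ^δ ⁅ e ⁆)} {ε[ insertAt F e false ]}
    {π[ ⁅ e ⁆ ]} (proj₁ G-valid) (ε[]-involutive _) (π[]-involutive ⁅ e ⁆) (λ p → refl) (ε[]-partialDual F e)

bc-partialDual : ∀ (G : Ribbon (suc m)) → IsRibbon G → ∀ e F →
  bc G (insertAt F e true) ≡ bc (G ^δ ⁅ e ⁆) (insertAt F e false)
bc-partialDual G G-valid e F = cong (_+ iso G) (sym (orbits-partialDual G G-valid e F))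

bc-contraction : ∀ (G : Ribbon (suc m)) → IsRibbon G → ∀ e F → bc G (insertAt F e true) ≡ bc (G / e) F
bc-contraction G G-valid e F = trans (bc-partialDual G G-valid e F)
  (Deletion.bc-deletion (G ^δ ⁅ e ⁆) (partialDual-valid G ⁅ e ⁆ G-valid) e F)

∑-subsets-suc : ∀ (g : Subset (suc m) → ℕ) →
  ∑ (subsets (suc m)) g ≡ ∑ (subsets m) (g ∘ (true ∷_)) + ∑ (subsets m) (g ∘ (false ∷_))
∑-subsets-suc {m} g = trans (∑-++ (map (true ∷_) (subsets m)) _ g)
  (cong₂ _+_ (∑-map (subsets m) (true ∷_) g) (∑-map (subsets m) (false ∷_) g))

∑-subsets-insertAt : ∀ (e : Fin (suc m)) (g : Subset (suc m) → ℕ) →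
  ∑ (subsets (suc m)) g ≡
  ∑ (subsets m) (λ F → g (insertAt F e true)) + ∑ (subsets m) (λ F → g (insertAt F e false))
∑-subsets-insertAt         zero    g = ∑-subsets-suc g
∑-subsets-insertAt {suc m} (suc e) g = begin
  ∑ (subsets (suc (suc m))) g
    ≡⟨ ∑-subsets-suc g ⟩
  ∑ (subsets (suc m)) (g ∘ (true ∷_)) + ∑ (subsets (suc m)) (g ∘ (false ∷_))
    ≡⟨ cong₂ _+_ (∑-subsets-insertAt e (g ∘ (true ∷_))) (∑-subsets-insertAt e (g ∘ (false ∷_))) ⟩
  (with-e true true + with-e true false) + (with-e false true + with-e false false)
    ≡⟨ interchange (with-e true true) (with-e true false) (with-e false true) (with-e false false) ⟩
  (with-e true true + with-e false true) + (with-e true false + with-e false false)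
    ≡⟨ cong₂ _+_ (∑-subsets-suc (λ F → g (insertAt F (suc e) true)))
                 (∑-subsets-suc (λ F → g (insertAt F (suc e) false))) ⟨
  ∑ (subsets (suc m)) (λ F → g (insertAt F (suc e) true))
    + ∑ (subsets (suc m)) (λ F → g (insertAt F (suc e) false)) ∎
  where
  open ≡-Reasoning
  with-e : Bool → Bool → ℕ
  with-e b₀ b = ∑[ F ∈ subsets m ] g (b₀ ∷ insertAt F e b)

χ-bc : ℕ → Ribbon m → Subset m → ℕ
χ-bc n G F = χ (does (bc G F ≟ℕ n))

f-∑ : ∀ n (G : Ribbon m) → f n G ≡ ∑ (subsets m) (χ-bc n G)
f-∑ {m} n G = length-filter-∑ (λ F → bc G F ≟ℕ n) (subsets m)

f-deletion-contraction : ∀ (G : Ribbon (suc m)) → IsRibbon G → ∀ e n → f n G ≡ f n (G \\ e) + f n (G / e)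
f-deletion-contraction {m} G G-valid e n = begin
  f n G
    ≡⟨ f-∑ n G ⟩
  ∑ (subsets (suc m)) (χ-bc n G)
    ≡⟨ ∑-subsets-insertAt e (χ-bc n G) ⟩
  ∑ (subsets m) (λ F → χ-bc n G (insertAt F e true)) + ∑ (subsets m) (λ F → χ-bc n G (insertAt F e false))
    ≡⟨ cong₂ _+_ (∑-cong (subsets m) (cong (λ k → χ (does (k ≟ℕ n))) ∘ bc-contraction G G-valid e))
                 (∑-cong (subsets m) (cong (λ k → χ (does (k ≟ℕ n))) ∘ Deletion.bc-deletion G G-valid e)) ⟩
  ∑ (subsets m) (χ-bc n (G / e)) + ∑ (subsets m) (χ-bc n (G \\ e))
    ≡⟨ cong₂ _+_ (f-∑ n (G / e)) (f-∑ n (G \\ e)) ⟨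
  f n (G / e) + f n (G \\ e)
    ≡⟨ +-comm (f n (G / e)) (f n (G \\ e)) ⟩
  f n (G \\ e) + f n (G / e) ∎
  where open ≡-Reasoning

-- The recurrence holds for every n.
theorem5p6 : ∀ {m : ℕ} (G : Ribbon (suc m)) → IsRibbon G → (e : Fin (suc m))
    → ((n : ℕ) → 1 ≤ n → f n G ≡ f n (G \\ e) + f n (G / e))
    × (κ G ≡ κ (G \\ e) + κ (G / e))
theorem5p6 G G-valid e = (λ n _ → f-deletion-contraction G G-valid e n) , f-deletion-contraction G G-valid e 1
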